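{- For every positive integer $\omega$ there is a circle graph with clique number at most $\omega$ and chromatic number at least $\omega(\ln \omega - 2)$.
   Context: A circle graph is the intersection graph of a finite set of chords of a circle: vertices correspond to chords and two vertices are adjacent when their chords intersect. -}

module Defs where

open import Data.Nat using (ℕ; zero; suc; _<_; NonZero)
open import Data.Fin using (Fin)
open import Data.List using (List; length)
open import Data.List.Relation.Unary.AllPairs using (AllPairs)
open import Data.Product using (_×_; Σ; ∃; _,_)
open import Data.Sum using (_⊎_)
open import Data.Integer using (+_)
open import Data.Rational as ℚ using (ℚ; 0ℚ; 1ℚ; _/_)
open import Relation.Binary.PropositionalEquality using (_≢_)

Graph : ℕ → Set₁
Graph n = Fin n → Fin n → Set

IsClique : ∀ {n} → Graph n → List (Fin n) → Set
IsClique G xs = AllPairs G xs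

CliqueNumber≤ : ∀ {n} → Graph n → ℕ → Set
CliqueNumber≤ G w = ∀ xs → IsClique G xs → length xs Data.Nat.≤ w

ProperColouring : ∀ {n} → Graph n → (k : ℕ) → (Fin n → Fin k) → Set
ProperColouring {n} G k c = ∀ (i j : Fin n) → G i j → c i ≢ c j

-- Cutting the circle at a point not on any chord, the endpoints of the
-- chords become points of a line, here natural numbers, listed in cyclic
-- order.  Endpoints of distinct
-- chords are distinct (general position; this loses no circle graphs).
-- Two chords intersect iff their endpoints interleave.

record Chord : Set where
  constructor chord
  field
    l r : ℕ
    l<r : l < r
open Chord public

Crosses : Chord → Chord → Set
Crosses c d = (l c < l d × l d < r c × r c < r d)
            ⊎ (l d < l c × l c < r d × r d < r c)

record ChordDiagram (n : ℕ) : Set where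
  constructor diagram
  field
    chords    : Fin n → Chord
    distinct  : ∀ (i j : Fin n) → i ≢ j →
                  (l (chords i) ≢ l (chords j)) × (l (chords i) ≢ r (chords j))
                × (r (chords i) ≢ l (chords j)) × (r (chords i) ≢ r (chords j))
open ChordDiagram public

circleGraph : ∀ {n} → ChordDiagram n → Graph n
circleGraph D i j = i ≢ j × Crosses (chords D i) (chords D j)

expTerm : ℚ → ℕ → ℚ
expTerm q zero    = 1ℚ
expTerm q (suc j) = expTerm q j ℚ.* (q ℚ.* (+ 1 / suc j))

expPartial : ℚ → ℕ → ℚ
expPartial q zero    = 1ℚ
expPartial q (suc N) = expPartial q N ℚ.+ expTerm q (suc N)

-- For real x = χ / ω (χ, ω naturals, ω > 0):
--   χ ≥ ω (ln ω − 2)  ⇔  e^{χ/ω + 2} ≥ ω  ⇔  ∃ N. expPartial (χ/ω + 2) N ≥ ω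
-- (the last step: partial sums increase strictly to e^q for q > 0, and
--  e^q ≠ ω since e^q is irrational for rational q ≠ 0).
AtLeastωLnωMinus2 : (χ ω : ℕ) → .{{NonZero ω}} → Set
AtLeastωLnωMinus2 χ ω =
  ∃ λ N → (+ ω / 1) ℚ.≤ expPartial ((+ χ / ω) ℚ.+ (+ 2 / 1)) N

ChromaticNumber≥ωLnωMinus2 : ∀ {n} → Graph n → (ω : ℕ) → .{{NonZero ω}} → Set
ChromaticNumber≥ωLnωMinus2 G ω =
  ∀ (k : ℕ) (c : _ → Fin k) → ProperColouring G k c → AtLeastωLnωMinus2 k ω

{-# OPTIONS --safe #-}
-- For 2 ≤ d < ω, every integer interval [s, s + d] with s < M carries chords of every rank
-- i < ⌊ω/d⌋.  Endpoints at a common integer are ordered so that two chords cross exactly when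
-- their intervals overlap without nesting, or are twins (same interval, different ranks).
-- A clique has a shortest member [a, a + L]; every member has exactly one endpoint in
-- [a, a + L), and this endpoint together with its rank (< ⌊ω/L⌋) is an injective slot below ω.
-- In a proper k-colouring every interval has an interior point lying inside no same-coloured
-- proper subinterval; colour and point determine the interval, so S²ω ≤ k (Sω + ω) for
-- M = Sω and S = Σ_{d=2}^{ω-1} ⌊ω/d⌋, whence S ≤ k.  Finally, the exponential partial sums
-- satisfy E_n(x)(1 + y) ≤ E_{n+1}(x + y), so n + 1 ≤ E_n(Σ_{m<n} c_m / ω) as soon as
-- (m + 1) c_m ≥ ω; with c_m = ⌊ω/(m+1)⌋ + 1 this gives ω ≤ E_{ω-1}((S + 2ω)/ω) ≤ E_{ω-1}(k/ω + 2).
module Submission where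

open import Defs
open import Data.Empty using (⊥-elim)
open import Data.Fin as Fin using (Fin; toℕ; splitAt; remQuot; combine; _↑ˡ_; _↑ʳ_)
import Data.Fin.Properties as Fin
import Data.Integer as ℤ
import Data.Integer.Properties as ℤ
import Data.Integer.Solver as ℤ-Solver
open import Data.List using (List; []; _∷_; length; lookup)
open import Data.List.Membership.Propositional.Properties using (∈-lookup)
import Data.List.Relation.Unary.All as All
open import Data.List.Relation.Unary.AllPairs using (AllPairs; _∷_)
open import Data.Nat as ℕ using (ℕ; zero; suc; z≤n; s≤s; NonZero)
import Data.Nat.Properties as ℕ
open import Data.Nat.DivMod using (m≡m%n+[m/n]*n; m%n<n; n/1≡n; m/n≤m; /-monoʳ-≤; m/n*n≤m)
import Data.Nat.Solver as ℕ-Solver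
open import Data.Product using (_×_; _,_; proj₁; proj₂; ∃; uncurry)
open import Data.Rational as ℚ using (ℚ; 0ℚ; 1ℚ; toℚᵘ)
import Data.Rational.Properties as ℚ
import Data.Rational.Solver as ℚ-Solver
open import Data.Rational.Unnormalised as ℚᵘ using (mkℚᵘ; *≡*; *≤*)
import Data.Rational.Unnormalised.Properties as ℚᵘ
open import Data.Sum using (_⊎_; inj₁; inj₂; [_,_]′)
open import Function using (_∘_)
open import Relation.Binary.Definitions using (tri<; tri≈; tri>)
open import Relation.Binary.PropositionalEquality
open import Relation.Nullary using (¬_; Dec; yes; no)
open import Relation.Nullary.Decidable using (_×-dec_; _⊎-dec_)

sumBelow : ℕ → (ℕ → ℕ) → ℕ
sumBelow zero    f = 0
sumBelow (suc n) f = sumBelow n f ℕ.+ f n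

module ExpEstimates where

  open import Data.Integer using (+_; +≤+)
  open import Data.Rational using (_/_; _+_; _*_; _≤_)

  fromℕ : ℕ → ℚ
  fromℕ n = + n / 1

  private
    ↧-+ : ∀ a b d e → ℚᵘ.↧ (mkℚᵘ a d ℚᵘ.+ mkℚᵘ b e) ≡ + suc d ℤ.* + suc e
    ↧-+ a b d e = trans (ℚᵘ.↧[n/d]≡d (a ℤ.* + suc e ℤ.+ b ℤ.* + suc d) (suc d ℕ.* suc e)) (ℤ.pos-* (suc d) (suc e))

    ↧-* : ∀ a b d e → ℚᵘ.↧ (mkℚᵘ a d ℚᵘ.* mkℚᵘ b e) ≡ + suc d ℤ.* + suc e
    ↧-* a b d e = trans (ℚᵘ.↧[n/d]≡d (a ℤ.* b) (suc d ℕ.* suc e)) (ℤ.pos-* (suc d) (suc e))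

    mkℚᵘ-+ : ∀ m n d → mkℚᵘ (+ (m ℕ.+ n)) d ℚᵘ.≃ mkℚᵘ (+ m) d ℚᵘ.+ mkℚᵘ (+ n) d
    mkℚᵘ-+ m n d = *≡* (trans (cong₂ ℤ._*_ (ℤ.pos-+ m n) (↧-+ (+ m) (+ n) d d))
      (solve 3 (λ m n D → (m :+ n) :* (D :* D) := (m :* D :+ n :* D) :* D) refl (+ m) (+ n) (+ suc d)))
      where open ℤ-Solver.+-*-Solver

    mkℚᵘ-* : ∀ m n d → mkℚᵘ (+ (m ℕ.* n)) d ℚᵘ.≃ mkℚᵘ (+ m) 0 ℚᵘ.* mkℚᵘ (+ n) d
    mkℚᵘ-* m n d = *≡* (trans (cong₂ ℤ._*_ (ℤ.pos-* m n) (↧-* (+ m) (+ n) 0 d))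
      (solve 3 (λ m n D → (m :* n) :* (con (+ 1) :* D) := (m :* n) :* D) refl (+ m) (+ n) (+ suc d)))
      where open ℤ-Solver.+-*-Solver

    toℚᵘ-/ : ∀ n d → toℚᵘ (+ n / suc d) ℚᵘ.≃ mkℚᵘ (+ n) d
    toℚᵘ-/ n d = ℚ.toℚᵘ-fromℚᵘ (mkℚᵘ (+ n) d)

  /-+ : ∀ m n d → + (m ℕ.+ n) / suc d ≡ + m / suc d + + n / suc d
  /-+ m n d = ℚ.toℚᵘ-injective (begin
    toℚᵘ (+ (m ℕ.+ n) / suc d)                  ≈⟨ toℚᵘ-/ (m ℕ.+ n) d ⟩
    mkℚᵘ (+ (m ℕ.+ n)) d                        ≈⟨ mkℚᵘ-+ m n d ⟩
    mkℚᵘ (+ m) d ℚᵘ.+ mkℚᵘ (+ n) d              ≈⟨ ℚᵘ.+-cong (toℚᵘ-/ m d) (toℚᵘ-/ n d) ⟨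
    toℚᵘ (+ m / suc d) ℚᵘ.+ toℚᵘ (+ n / suc d)  ≈⟨ ℚ.toℚᵘ-homo-+ (+ m / suc d) (+ n / suc d) ⟨
    toℚᵘ (+ m / suc d + + n / suc d)            ∎)
    where open ℚᵘ.≃-Reasoning

  fromℕ-*-/ : ∀ m n d → fromℕ m * (+ n / suc d) ≡ + (m ℕ.* n) / suc d
  fromℕ-*-/ m n d = ℚ.toℚᵘ-injective (begin
    toℚᵘ (fromℕ m * (+ n / suc d))              ≈⟨ ℚ.toℚᵘ-homo-* (fromℕ m) (+ n / suc d) ⟩
    toℚᵘ (fromℕ m) ℚᵘ.* toℚᵘ (+ n / suc d)      ≈⟨ ℚᵘ.*-cong (toℚᵘ-/ m 0) (toℚᵘ-/ n d) ⟩
    mkℚᵘ (+ m) 0 ℚᵘ.* mkℚᵘ (+ n) d              ≈⟨ mkℚᵘ-* m n d ⟨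
    mkℚᵘ (+ (m ℕ.* n)) d                        ≈⟨ toℚᵘ-/ (m ℕ.* n) d ⟨
    toℚᵘ (+ (m ℕ.* n) / suc d)                  ∎)
    where open ℚᵘ.≃-Reasoning

  [1+d]/[1+d]≡1 : ∀ d → + suc d / suc d ≡ 1ℚ
  [1+d]/[1+d]≡1 d = ℚ.toℚᵘ-injective (ℚᵘ.≃-trans (toℚᵘ-/ (suc d) d) (*≡* (ℤ.*-comm (+ suc d) (+ 1))))

  /-mono-≤ : ∀ {m n} d → m ℕ.≤ n → + m / suc d ≤ + n / suc d
  /-mono-≤ {m} {n} d m≤n = ℚ.toℚᵘ-cancel-≤
    (ℚᵘ.≤-respˡ-≃ (ℚᵘ.≃-sym (toℚᵘ-/ m d)) (ℚᵘ.≤-respʳ-≃ (ℚᵘ.≃-sym (toℚᵘ-/ n d))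
      (*≤* (ℤ.*-monoʳ-≤-nonNeg (+ suc d) (+≤+ m≤n)))))

  0≤/ : ∀ n d → 0ℚ ≤ + n / suc d
  0≤/ n d = subst (_≤ + n / suc d) (ℚ.0/n≡0 (suc d)) (/-mono-≤ {0} {n} d z≤n)

  fromℕ-*-inverse : ∀ d → fromℕ (suc d) * (+ 1 / suc d) ≡ 1ℚ
  fromℕ-*-inverse d = trans (fromℕ-*-/ (suc d) 1 d)
    (trans (cong (λ n → + n / suc d) (ℕ.*-identityʳ (suc d))) ([1+d]/[1+d]≡1 d))

  *-mono-≤-nonNeg : ∀ {p q r s} → 0ℚ ≤ p → 0ℚ ≤ r → p ≤ q → r ≤ s → p * r ≤ q * s
  *-mono-≤-nonNeg {p} {q} {r} {s} 0≤p 0≤r p≤q r≤s = ℚ.≤-trans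
    (ℚ.*-monoʳ-≤-nonNeg r {{ℚ.nonNegative 0≤r}} p≤q)
    (ℚ.*-monoˡ-≤-nonNeg q {{ℚ.nonNegative (ℚ.≤-trans 0≤p p≤q)}} r≤s)

  0≤* : ∀ {p q} → 0ℚ ≤ p → 0ℚ ≤ q → 0ℚ ≤ p * q
  0≤* 0≤p 0≤q = *-mono-≤-nonNeg ℚ.≤-refl ℚ.≤-refl 0≤p 0≤q

  p≤p+q : ∀ {p q} → 0ℚ ≤ q → p ≤ p + q
  p≤p+q {p} 0≤q = ℚ.≤-trans (ℚ.≤-reflexive (sym (ℚ.+-identityʳ p))) (ℚ.+-monoʳ-≤ p 0≤q)

  module _ {x : ℚ} (0≤x : 0ℚ ≤ x) where

    expTerm-nonNeg : ∀ j → 0ℚ ≤ expTerm x j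
    expTerm-nonNeg zero    = 0≤/ 1 0
    expTerm-nonNeg (suc j) = 0≤* (expTerm-nonNeg j) (0≤* 0≤x (0≤/ 1 j))

    expTerm-monoˡ-≤ : ∀ {z} → x ≤ z → ∀ j → expTerm x j ≤ expTerm z j
    expTerm-monoˡ-≤ x≤z zero    = ℚ.≤-refl
    expTerm-monoˡ-≤ x≤z (suc j) = *-mono-≤-nonNeg (expTerm-nonNeg j) (0≤* 0≤x (0≤/ 1 j))
      (expTerm-monoˡ-≤ x≤z j) (ℚ.*-monoʳ-≤-nonNeg (+ 1 / suc j) {{ℚ.nonNegative (0≤/ 1 j)}} x≤z)

    expPartial-monoˡ-≤ : ∀ {z} → x ≤ z → ∀ N → expPartial x N ≤ expPartial z N
    expPartial-monoˡ-≤ x≤z zero    = ℚ.≤-refl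
    expPartial-monoˡ-≤ x≤z (suc N) = ℚ.+-mono-≤ (expPartial-monoˡ-≤ x≤z N) (expTerm-monoˡ-≤ x≤z (suc N))

  [1+j]*expTerm[1+j]≡expTerm*x : ∀ x j → fromℕ (suc j) * expTerm x (suc j) ≡ expTerm x j * x
  [1+j]*expTerm[1+j]≡expTerm*x x j = begin
    i * (t * (x * h))  ≡⟨ solve 4 (λ i t x h → i :* (t :* (x :* h)) := (t :* x) :* (i :* h)) refl i t x h ⟩
    (t * x) * (i * h)  ≡⟨ cong ((t * x) *_) (fromℕ-*-inverse j) ⟩
    (t * x) * 1ℚ       ≡⟨ ℚ.*-identityʳ (t * x) ⟩
    t * x              ∎
    where
    open ≡-Reasoning
    open ℚ-Solver.+-*-Solver
    i = fromℕ (suc j)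
    t = expTerm x j
    h = + 1 / suc j

  module _ {x y : ℚ} (0≤x : 0ℚ ≤ x) (0≤y : 0ℚ ≤ y) where

    expTerm-+-≤ : ∀ j → expTerm x (suc j) + y * expTerm x j ≤ expTerm (x + y) (suc j)
    expTerm-+-≤ zero = ℚ.≤-reflexive
      (solve 2 (λ x y → con 1ℚ :* (x :* con 1ℚ) :+ y :* con 1ℚ := con 1ℚ :* ((x :+ y) :* con 1ℚ)) refl x y)
      where open ℚ-Solver.+-*-Solver
    expTerm-+-≤ (suc j) = begin
      a * (x * h) + y * a                  ≤⟨ p≤p+q (0≤* (0≤* (0≤* 0≤y 0≤y) (expTerm-nonNeg 0≤x j)) (0≤/ 1 (suc j))) ⟩
      a * (x * h) + y * a + y * y * b * h  ≡⟨ expand ⟨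
      (a + y * b) * ((x + y) * h)          ≤⟨ ℚ.*-monoʳ-≤-nonNeg ((x + y) * h) {{ℚ.nonNegative 0≤[x+y]h}} (expTerm-+-≤ j) ⟩
      expTerm (x + y) (suc (suc j))        ∎
      where
      open ℚ.≤-Reasoning
      open ℚ-Solver.+-*-Solver
      a = expTerm x (suc j)
      b = expTerm x j
      h = + 1 / suc (suc j)
      0≤[x+y]h : 0ℚ ≤ (x + y) * h
      0≤[x+y]h = 0≤* (ℚ.+-mono-≤ 0≤x 0≤y) (0≤/ 1 (suc j))
      [2+j]h≡1 : (1ℚ + fromℕ (suc j)) * h ≡ 1ℚ
      [2+j]h≡1 = trans (cong (_* h) (sym (/-+ 1 (suc j) 0))) (fromℕ-*-inverse (suc j))
      -- the cross term y b x h equals y (j+1) a h, which together with y a h gives y a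
      expand : (a + y * b) * ((x + y) * h) ≡ a * (x * h) + y * a + y * y * b * h
      expand = begin-equality
        (a + y * b) * ((x + y) * h)
          ≡⟨ solve 5 (λ a b x y h → (a :+ y :* b) :* ((x :+ y) :* h)
                                  := a :* (x :* h) :+ a :* y :* h :+ y :* (b :* x) :* h :+ y :* y :* b :* h)
                     refl a b x y h ⟩
        a * (x * h) + a * y * h + y * (b * x) * h + y * y * b * h
          ≡⟨ cong (λ z → a * (x * h) + a * y * h + y * z * h + y * y * b * h) (sym ([1+j]*expTerm[1+j]≡expTerm*x x j)) ⟩
        a * (x * h) + a * y * h + y * (i * a) * h + y * y * b * h
          ≡⟨ solve 6 (λ a b x y h i → a :* (x :* h) :+ a :* y :* h :+ y :* (i :* a) :* h :+ y :* y :* b :* h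
                                    := a :* (x :* h) :+ y :* a :* ((con 1ℚ :+ i) :* h) :+ y :* y :* b :* h)
                     refl a b x y h i ⟩
        a * (x * h) + y * a * ((1ℚ + i) * h) + y * y * b * h
          ≡⟨ cong (λ z → a * (x * h) + y * a * z + y * y * b * h) [2+j]h≡1 ⟩
        a * (x * h) + y * a * 1ℚ + y * y * b * h
          ≡⟨ cong (λ z → a * (x * h) + z + y * y * b * h) (ℚ.*-identityʳ (y * a)) ⟩
        a * (x * h) + y * a + y * y * b * h ∎
        where i = fromℕ (suc j)

    expPartial-+-≤ : ∀ N → expPartial x (suc N) + y * expPartial x N ≤ expPartial (x + y) (suc N)
    expPartial-+-≤ zero =
      ℚ.≤-trans (ℚ.≤-reflexive (ℚ.+-assoc 1ℚ (expTerm x 1) (y * 1ℚ))) (ℚ.+-monoʳ-≤ 1ℚ (expTerm-+-≤ 0))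
    expPartial-+-≤ (suc N) = begin
      E (suc (suc N)) + y * E (suc N)
        ≡⟨ regroup ⟩
      (E (suc N) + y * E N) + (expTerm x (suc (suc N)) + y * expTerm x (suc N))
        ≤⟨ ℚ.+-mono-≤ (expPartial-+-≤ N) (expTerm-+-≤ (suc N)) ⟩
      expPartial (x + y) (suc (suc N))
        ∎
      where
      open ℚ.≤-Reasoning
      open ℚ-Solver.+-*-Solver
      E = expPartial x
      regroup : E (suc (suc N)) + y * E (suc N) ≡ (E (suc N) + y * E N) + (expTerm x (suc (suc N)) + y * expTerm x (suc N))
      regroup = solve 4 (λ e t₁ t₂ y → ((e :+ t₁) :+ t₂) :+ y :* (e :+ t₁) := ((e :+ t₁) :+ y :* e) :+ (t₂ :+ y :* t₁))
        refl (E N) (expTerm x (suc N)) (expTerm x (suc (suc N))) y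

    expPartial-*-1+-≤ : ∀ N → expPartial x N * (1ℚ + y) ≤ expPartial (x + y) (suc N)
    expPartial-*-1+-≤ N = begin
      E N * (1ℚ + y)              ≡⟨ solve 2 (λ e y → e :* (con 1ℚ :+ y) := e :+ y :* e) refl (E N) y ⟩
      E N + y * E N               ≤⟨ ℚ.+-monoˡ-≤ (y * E N) (p≤p+q {E N} (expTerm-nonNeg 0≤x (suc N))) ⟩
      E (suc N) + y * E N         ≤⟨ expPartial-+-≤ N ⟩
      expPartial (x + y) (suc N)  ∎
      where
      open ℚ.≤-Reasoning
      open ℚ-Solver.+-*-Solver
      E = expPartial x

  module _ (p : ℕ) (c : ℕ → ℕ) (ω≤[1+n]c : ∀ n → suc p ℕ.≤ suc n ℕ.* c n) where

    private
      ω = suc p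

    fromℕ[2+n]≤fromℕ[1+n]*[1+c/ω] : ∀ n → fromℕ (suc (suc n)) ≤ fromℕ (suc n) * (1ℚ + + c n / ω)
    fromℕ[2+n]≤fromℕ[1+n]*[1+c/ω] n = begin
      fromℕ (suc (suc n))                   ≡⟨ cong (λ m → + m / 1) (ℕ.+-comm 1 (suc n)) ⟩
      fromℕ (suc n ℕ.+ 1)                   ≡⟨ /-+ (suc n) 1 0 ⟩
      fromℕ (suc n) + 1ℚ                    ≡⟨ cong (λ q → fromℕ (suc n) + q) ([1+d]/[1+d]≡1 p) ⟨
      fromℕ (suc n) + + ω / ω               ≤⟨ ℚ.+-monoʳ-≤ (fromℕ (suc n)) (/-mono-≤ p (ω≤[1+n]c n)) ⟩
      fromℕ (suc n) + + (suc n ℕ.* c n) / ω ≡⟨ cong₂ _+_ (ℚ.*-identityʳ (fromℕ (suc n))) (fromℕ-*-/ (suc n) (c n) p) ⟨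
      fromℕ (suc n) * 1ℚ + fromℕ (suc n) * (+ c n / ω)  ≡⟨ ℚ.*-distribˡ-+ (fromℕ (suc n)) 1ℚ (+ c n / ω) ⟨
      fromℕ (suc n) * (1ℚ + + c n / ω)      ∎
      where open ℚ.≤-Reasoning

    fromℕ[1+n]≤expPartial : ∀ n → fromℕ (suc n) ≤ expPartial (+ sumBelow n c / ω) n
    fromℕ[1+n]≤expPartial zero    = ℚ.≤-refl
    fromℕ[1+n]≤expPartial (suc n) = begin
      fromℕ (suc (suc n))                           ≤⟨ fromℕ[2+n]≤fromℕ[1+n]*[1+c/ω] n ⟩
      fromℕ (suc n) * (1ℚ + c/ω)
        ≤⟨ ℚ.*-monoʳ-≤-nonNeg (1ℚ + c/ω) {{ℚ.nonNegative 0≤1+c/ω}} (fromℕ[1+n]≤expPartial n) ⟩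
      expPartial s/ω n * (1ℚ + c/ω)                 ≤⟨ expPartial-*-1+-≤ (0≤/ (sumBelow n c) p) (0≤/ (c n) p) n ⟩
      expPartial (s/ω + c/ω) (suc n)                ≡⟨ cong (λ z → expPartial z (suc n)) (/-+ (sumBelow n c) (c n) p) ⟨
      expPartial (+ sumBelow (suc n) c / ω) (suc n) ∎
      where
      open ℚ.≤-Reasoning
      c/ω = + c n / ω
      s/ω = + sumBelow n c / ω
      0≤1+c/ω : 0ℚ ≤ 1ℚ + c/ω
      0≤1+c/ω = ℚ.+-mono-≤ (0≤/ 1 0) (0≤/ (c n) p)

  sumBelow≤⇒AtLeastωLnωMinus2 : ∀ p (c : ℕ → ℕ) → (∀ n → suc p ℕ.≤ suc n ℕ.* c n) →
                                 ∀ k → sumBelow p c ℕ.≤ k ℕ.+ 2 ℕ.* suc p → AtLeastωLnωMinus2 k (suc p)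
  sumBelow≤⇒AtLeastωLnωMinus2 p c ω≤[1+n]c k sum≤ = p , (begin
    fromℕ ω                             ≤⟨ fromℕ[1+n]≤expPartial p c ω≤[1+n]c p ⟩
    expPartial (+ sumBelow p c / ω) p   ≤⟨ expPartial-monoˡ-≤ (0≤/ (sumBelow p c) p) exponent-≤ p ⟩
    expPartial (+ k / ω + fromℕ 2) p    ∎)
    where
    open ℚ.≤-Reasoning
    ω = suc p
    2ω/ω≡2 : + (2 ℕ.* ω) / ω ≡ fromℕ 2
    2ω/ω≡2 = trans (sym (fromℕ-*-/ 2 ω p)) (trans (cong (fromℕ 2 *_) ([1+d]/[1+d]≡1 p)) (ℚ.*-identityʳ (fromℕ 2)))
    exponent-≤ : + sumBelow p c / ω ≤ + k / ω + fromℕ 2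
    exponent-≤ = begin
      + sumBelow p c / ω          ≤⟨ /-mono-≤ p sum≤ ⟩
      + (k ℕ.+ 2 ℕ.* ω) / ω       ≡⟨ /-+ k (2 ℕ.* ω) p ⟩
      + k / ω + + (2 ℕ.* ω) / ω   ≡⟨ cong (λ q → + k / ω + q) 2ω/ω≡2 ⟩
      + k / ω + fromℕ 2           ∎

open ExpEstimates using (sumBelow≤⇒AtLeastωLnωMinus2)
open import Data.Nat using (_+_; _*_; _∸_; _≤_; _<_; _/_; _%_)

sumBelow-suc : ∀ n f → sumBelow n (λ m → suc (f m)) ≡ n + sumBelow n f
sumBelow-suc zero    f = refl
sumBelow-suc (suc n) f = begin
  sumBelow n (λ m → suc (f m)) + suc (f n)  ≡⟨ cong (_+ suc (f n)) (sumBelow-suc n f) ⟩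
  n + sumBelow n f + suc (f n)              ≡⟨ ℕ.+-suc (n + sumBelow n f) (f n) ⟩
  suc (n + sumBelow n f + f n)              ≡⟨ cong suc (ℕ.+-assoc n (sumBelow n f) (f n)) ⟩
  suc n + (sumBelow n f + f n)              ∎
  where open ≡-Reasoning

sumBelow-shift : ∀ n f → sumBelow (suc n) f ≡ f 0 + sumBelow n (λ m → f (suc m))
sumBelow-shift zero    f = ℕ.+-comm 0 (f 0)
sumBelow-shift (suc n) f = trans (cong (_+ f (suc n)) (sumBelow-shift n f)) (ℕ.+-assoc (f 0) _ (f (suc n)))

floorSum : ℕ → ℕ
floorSum ω = sumBelow (ω ∸ 2) (λ j → ω / (2 + j))

ω≤[1+n]*[1+ω/[1+n]] : ∀ ω n → ω ≤ suc n * suc (ω / suc n)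
ω≤[1+n]*[1+ω/[1+n]] ω n = begin
  ω                                ≡⟨ m≡m%n+[m/n]*n ω (suc n) ⟩
  ω % suc n + (ω / suc n) * suc n  ≤⟨ ℕ.+-monoˡ-≤ _ (ℕ.<⇒≤ (m%n<n ω (suc n))) ⟩
  suc n + (ω / suc n) * suc n      ≡⟨ cong (suc n +_) (ℕ.*-comm (ω / suc n) (suc n)) ⟩
  suc n + suc n * (ω / suc n)      ≡⟨ ℕ.*-suc (suc n) (ω / suc n) ⟨
  suc n * suc (ω / suc n)          ∎
  where open ℕ.≤-Reasoning

sumBelow[1+ω/[1+m]]≤floorSum+2ω : ∀ p → let ω = suc p in
  sumBelow p (λ m → suc (ω / suc m)) ≤ floorSum ω + 2 * ω
sumBelow[1+ω/[1+m]]≤floorSum+2ω zero    = z≤n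
sumBelow[1+ω/[1+m]]≤floorSum+2ω (suc q) = begin
  sumBelow (suc q) (λ m → suc (ω / suc m))    ≡⟨ sumBelow-suc (suc q) (λ m → ω / suc m) ⟩
  suc q + sumBelow (suc q) (λ m → ω / suc m)  ≡⟨ cong (suc q +_) (sumBelow-shift q (λ m → ω / suc m)) ⟩
  suc q + (ω / 1 + floorSum ω)                ≡⟨ cong (λ n → suc q + (n + floorSum ω)) (n/1≡n ω) ⟩
  suc q + (ω + floorSum ω)                    ≤⟨ ℕ.+-monoˡ-≤ (ω + floorSum ω) (ℕ.n≤1+n (suc q)) ⟩
  ω + (ω + floorSum ω)                        ≡⟨ solve 2 (λ w s → w :+ (w :+ s) := s :+ con 2 :* w) refl ω (floorSum ω) ⟩
  floorSum ω + 2 * ω                          ∎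
  where
  open ℕ.≤-Reasoning
  open ℕ-Solver.+-*-Solver
  ω = suc (suc q)

floorSum≤⇒AtLeastωLnωMinus2 : ∀ ω .{{_ : NonZero ω}} k → floorSum ω ≤ k → AtLeastωLnωMinus2 k ω
floorSum≤⇒AtLeastωLnωMinus2 (suc p) k S≤k = sumBelow≤⇒AtLeastωLnωMinus2 p _ (ω≤[1+n]*[1+ω/[1+n]] (suc p)) k
  (ℕ.≤-trans (sumBelow[1+ω/[1+m]]≤floorSum+2ω p) (ℕ.+-monoˡ-≤ (2 * suc p) S≤k))

lex-<ˡ : ∀ {K p q r} s → p < q → r < K → p * K + r < q * K + s
lex-<ˡ {K} {p} {q} {r} s p<q r<K = begin-strict
  p * K + r   <⟨ ℕ.+-monoʳ-< (p * K) r<K ⟩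
  p * K + K   ≡⟨ ℕ.+-comm (p * K) K ⟩
  suc p * K   ≤⟨ ℕ.*-monoˡ-≤ K p<q ⟩
  q * K       ≤⟨ ℕ.m≤m+n (q * K) s ⟩
  q * K + s   ∎
  where open ℕ.≤-Reasoning

lex-<ʳ : ∀ {K p q r s} → p ≡ q → r < s → p * K + r < q * K + s
lex-<ʳ {K} {p} refl r<s = ℕ.+-monoʳ-< (p * K) r<s

lex-<⇒≤ˡ : ∀ {K p q r s} → p * K + r < q * K + s → s < K → p ≤ q
lex-<⇒≤ˡ {r = r} lt s<K = ℕ.≮⇒≥ (λ q<p → ℕ.<-asym lt (lex-<ˡ r q<p s<K))

lex-<⇒<ʳ : ∀ {K p q r s} → p * K + r < q * K + s → p ≡ q → r < s
lex-<⇒<ʳ {K} {p} lt refl = ℕ.+-cancelˡ-< (p * K) _ _ lt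

lex-injective : ∀ {K p q r s} → r < K → s < K → p * K + r ≡ q * K + s → p ≡ q × r ≡ s
lex-injective {K} {p} {q} {r} {s} r<K s<K eq with ℕ.<-cmp p q
... | tri< p<q _ _ = ⊥-elim (ℕ.<⇒≢ (lex-<ˡ s p<q r<K) eq)
... | tri> _ _ q<p = ⊥-elim (ℕ.<⇒≢ (lex-<ˡ r q<p s<K) (sym eq))
... | tri≈ _ refl _ = refl , ℕ.+-cancelˡ-≡ (p * K) r s eq

AllPairs-lookup : ∀ {A : Set} {R : A → A → Set} {xs : List A} → AllPairs R xs →
                  ∀ {p q} → p ≢ q → R (lookup xs p) (lookup xs q) ⊎ R (lookup xs q) (lookup xs p)
AllPairs-lookup (_ ∷ _)   {Fin.zero}  {Fin.zero}  p≢q = ⊥-elim (p≢q refl)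
AllPairs-lookup (rx ∷ _)  {Fin.zero}  {Fin.suc q} _   = inj₁ (All.lookup rx (∈-lookup q))
AllPairs-lookup (rx ∷ _)  {Fin.suc p} {Fin.zero}  _   = inj₂ (All.lookup rx (∈-lookup p))
AllPairs-lookup (_ ∷ rxs) {Fin.suc p} {Fin.suc q} p≢q = AllPairs-lookup rxs (p≢q ∘ cong Fin.suc)

argmin : ∀ m (f : Fin (suc m) → ℕ) → ∃ λ p → ∀ q → f p ≤ f q
argmin zero    f = Fin.zero , λ { Fin.zero → ℕ.≤-refl }
argmin (suc m) f with argmin m (f ∘ Fin.suc)
... | p , min with f Fin.zero ℕ.≤? f (Fin.suc p)
...   | yes f0≤ = Fin.zero , λ { Fin.zero → ℕ.≤-refl ; (Fin.suc q) → ℕ.≤-trans f0≤ (min q) }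
...   | no  f0≰ = Fin.suc p , λ { Fin.zero → ℕ.<⇒≤ (ℕ.≰⇒> f0≰) ; (Fin.suc q) → min q }

module _ (f : ℕ → ℕ) where

  decode : ∀ n → Fin (sumBelow n f) → ℕ × ℕ
  decode (suc n) t = [ decode n , (λ i → n , toℕ i) ]′ (splitAt (sumBelow n f) t)

  decode-bounds : ∀ n t → proj₁ (decode n t) < n × proj₂ (decode n t) < f (proj₁ (decode n t))
  decode-bounds (suc n) t with splitAt (sumBelow n f) t
  ... | inj₁ t′ = ℕ.m<n⇒m<1+n (proj₁ (decode-bounds n t′)) , proj₂ (decode-bounds n t′)
  ... | inj₂ i  = ℕ.n<1+n n , Fin.toℕ<n i

  decode-injective : ∀ n {t t′} → decode n t ≡ decode n t′ → t ≡ t′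
  decode-injective (suc n) {t} {t′} eq with splitAt (sumBelow n f) t in e | splitAt (sumBelow n f) t′ in e′
  ... | inj₁ s | inj₁ s′ =
    trans (sym (Fin.splitAt⁻¹-↑ˡ e)) (trans (cong (_↑ˡ _) (decode-injective n eq)) (Fin.splitAt⁻¹-↑ˡ e′))
  ... | inj₁ s | inj₂ i′ = ⊥-elim (ℕ.<-irrefl (cong proj₁ eq) (proj₁ (decode-bounds n s)))
  ... | inj₂ i | inj₁ s′ = ⊥-elim (ℕ.<-irrefl (sym (cong proj₁ eq)) (proj₁ (decode-bounds n s′)))
  ... | inj₂ i | inj₂ i′ =
    trans (sym (Fin.splitAt⁻¹-↑ʳ e))
          (trans (cong (sumBelow n f ↑ʳ_) (Fin.toℕ-injective (cong proj₂ eq))) (Fin.splitAt⁻¹-↑ʳ e′))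

m<n∸2⇒2+m<n : ∀ {m} n → m < n ∸ 2 → 2 + m < n
m<n∸2⇒2+m<n (suc (suc n)) m<n∸2 = s≤s (s≤s m<n∸2)

m*m≤k*[1+m]⇒m≤k : ∀ m k → m * m ≤ k * suc m → m ≤ k
m*m≤k*[1+m]⇒m≤k m k m*m≤k*[1+m] = ℕ.≮⇒≥ λ k<m → ℕ.<-irrefl refl (begin-strict
  m + k * suc m  <⟨ ℕ.+-monoˡ-< (k * suc m) (ℕ.n<1+n m) ⟩
  suc k * suc m  ≤⟨ ℕ.*-monoˡ-≤ (suc m) k<m ⟩
  m * suc m      ≡⟨ ℕ.*-suc m m ⟩
  m + m * m      ≤⟨ ℕ.+-monoʳ-≤ m m*m≤k*[1+m] ⟩
  m + k * suc m  ∎)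
  where open ℕ.≤-Reasoning

m*[m*n]≤k*[m*n+n]⇒m≤k : ∀ m k n .{{_ : NonZero n}} → m * (m * n) ≤ k * (m * n + n) → m ≤ k
m*[m*n]≤k*[m*n+n]⇒m≤k m k n le = m*m≤k*[1+m]⇒m≤k m k (ℕ.*-cancelʳ-≤ (m * m) (k * suc m) n (begin
  m * m * n        ≡⟨ ℕ.*-assoc m m n ⟩
  m * (m * n)      ≤⟨ le ⟩
  k * (m * n + n)  ≡⟨ cong (k *_) (ℕ.+-comm (m * n) n) ⟩
  k * (suc m * n)  ≡⟨ ℕ.*-assoc k (suc m) n ⟨
  k * suc m * n    ∎))
  where open ℕ.≤-Reasoning

module Construction (ω : ℕ) .{{_ : NonZero ω}} where

  S M N : ℕ
  S = floorSum ω
  M = S * ω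
  N = S * M

  shape : Fin N → ℕ × ℕ
  shape v = decode (λ j → ω / (2 + j)) (ω ∸ 2) (proj₁ (remQuot M v))

  start len rank end : Fin N → ℕ
  start v = toℕ (proj₂ (remQuot {S} M v))
  len   v = 2 + proj₁ (shape v)
  rank  v = proj₂ (shape v)
  end   v = start v + len v

  start<M : ∀ v → start v < M
  start<M v = Fin.toℕ<n (proj₂ (remQuot {S} M v))

  len<ω : ∀ v → len v < ω
  len<ω v = m<n∸2⇒2+m<n ω (proj₁ (decode-bounds _ (ω ∸ 2) _))

  rank<ω/len : ∀ v → rank v < ω / len v
  rank<ω/len v = proj₂ (decode-bounds _ (ω ∸ 2) _)

  rank<ω : ∀ v → rank v < ω
  rank<ω v = ℕ.<-≤-trans (rank<ω/len v) (m/n≤m ω (len v))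

  start<end : ∀ v → start v < end v
  start<end v = ℕ.m<m+n (start v) {len v} ℕ.z<s

  start-len-rank-injective : ∀ {v w} → start v ≡ start w → len v ≡ len w → rank v ≡ rank w → v ≡ w
  start-len-rank-injective {v} {w} sv≡sw lv≡lw rv≡rw = begin
    v                                       ≡⟨ Fin.combine-remQuot {S} M v ⟨
    uncurry combine (remQuot {S} M v)       ≡⟨ cong (uncurry combine) (cong₂ _,_ type-eq (Fin.toℕ-injective sv≡sw)) ⟩
    uncurry combine (remQuot {S} M w)       ≡⟨ Fin.combine-remQuot {S} M w ⟩
    w                                       ∎
    where
    open ≡-Reasoning
    type-eq : proj₁ (remQuot {S} M v) ≡ proj₁ (remQuot {S} M w)
    type-eq = decode-injective _ (ω ∸ 2) (cong₂ _,_ (ℕ.+-cancelˡ-≡ 2 _ _ lv≡lw) rv≡rw)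

  W K : ℕ
  W = ω * ω
  K = W + W

  -- At a common integer, right endpoints come before left ones, longer intervals start first,
  -- shorter ones end first, and ties go by rank: intervals that only touch, or are nested with
  -- a common endpoint, do not cross, while twins do.
  leftKey rightKey : Fin N → ℕ
  leftKey  v = W + ((ω ∸ len v) * ω + rank v)
  rightKey v = len v * ω + rank v

  left right : Fin N → ℕ
  left  v = start v * K + leftKey v
  right v = end v * K + rightKey v

  rightKey<W : ∀ v → rightKey v < W
  rightKey<W v = ℕ.<-≤-trans (lex-<ˡ 0 (len<ω v) (rank<ω v)) (ℕ.≤-reflexive (ℕ.+-identityʳ W))

  rightKey<leftKey : ∀ v w → rightKey v < leftKey w
  rightKey<leftKey v w = ℕ.<-≤-trans (rightKey<W v) (ℕ.m≤m+n W _)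

  leftKey<K : ∀ v → leftKey v < K
  leftKey<K v = ℕ.+-monoʳ-< W (ℕ.<-≤-trans (lex-<ˡ 0 ω∸len<ω (rank<ω v)) (ℕ.≤-reflexive (ℕ.+-identityʳ W)))
    where
    ω∸len<ω : ω ∸ len v < ω
    ω∸len<ω = ℕ.∸-monoʳ-< ℕ.z<s (ℕ.<⇒≤ (len<ω v))

  rightKey<K : ∀ v → rightKey v < K
  rightKey<K v = ℕ.<-≤-trans (rightKey<W v) (ℕ.m≤m+n W W)

  leftKey-injective : ∀ {v w} → leftKey v ≡ leftKey w → len v ≡ len w × rank v ≡ rank w
  leftKey-injective {v} {w} eq with lex-injective (rank<ω v) (rank<ω w) (ℕ.+-cancelˡ-≡ W _ _ eq)
  ... | ω∸lv≡ω∸lw , rv≡rw = ℕ.∸-cancelˡ-≡ (ℕ.<⇒≤ (len<ω v)) (ℕ.<⇒≤ (len<ω w)) ω∸lv≡ω∸lw , rv≡rw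

  rightKey-injective : ∀ {v w} → rightKey v ≡ rightKey w → len v ≡ len w × rank v ≡ rank w
  rightKey-injective {v} {w} = lex-injective (rank<ω v) (rank<ω w)

  left<right : ∀ v → left v < right v
  left<right v = lex-<ˡ (rightKey v) (start<end v) (leftKey<K v)

  chordOf : Fin N → Chord
  chordOf v = chord (left v) (right v) (left<right v)

  left-injective : ∀ {v w} → left v ≡ left w → v ≡ w
  left-injective {v} {w} eq with lex-injective (leftKey<K v) (leftKey<K w) eq
  ... | sv≡sw , keys with leftKey-injective keys
  ...   | lv≡lw , rv≡rw = start-len-rank-injective sv≡sw lv≡lw rv≡rw

  right-injective : ∀ {v w} → right v ≡ right w → v ≡ w
  right-injective {v} {w} eq with lex-injective (rightKey<K v) (rightKey<K w) eq
  ... | ev≡ew , keys with rightKey-injective keys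
  ...   | lv≡lw , rv≡rw = start-len-rank-injective sv≡sw lv≡lw rv≡rw
    where
    sv≡sw : start v ≡ start w
    sv≡sw = ℕ.+-cancelʳ-≡ (len v) _ _ (trans ev≡ew (cong (start w +_) (sym lv≡lw)))

  left≢right : ∀ v w → left v ≢ right w
  left≢right v w eq = ℕ.<-irrefl (sym keys≡) (rightKey<leftKey w v)
    where
    keys≡ : leftKey v ≡ rightKey w
    keys≡ = proj₂ (lex-injective {p = start v} {q = end w} (leftKey<K v) (rightKey<K w) eq)

  chordDiagram : ChordDiagram N
  chordDiagram = diagram chordOf λ v w v≢w →
    (v≢w ∘ left-injective) , left≢right v w , (left≢right w v ∘ sym) , (v≢w ∘ right-injective)

  G : Graph N
  G = circleGraph chordDiagram

  Overlap Twins Meets : Fin N → Fin N → Set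
  Overlap v w = start v < start w × start w < end v × end v < end w
  Twins   v w = start v ≡ start w × len v ≡ len w
  Meets   v w = Overlap v w ⊎ Overlap w v ⊎ Twins v w

  Meets-sym : ∀ {v w} → Meets v w → Meets w v
  Meets-sym (inj₁ o)               = inj₂ (inj₁ o)
  Meets-sym (inj₂ (inj₁ o))        = inj₁ o
  Meets-sym (inj₂ (inj₂ (s≡ , l≡))) = inj₂ (inj₂ (sym s≡ , sym l≡))

  end<end⇒len<len : ∀ {v w} → start v ≡ start w → end v < end w → len v < len w
  end<end⇒len<len {v} {w} sv≡sw ev<ew =
    ℕ.+-cancelˡ-< (start v) _ _ (subst (λ s → end v < s + len w) (sym sv≡sw) ev<ew)

  left<left⇒ : ∀ {v w} → left v < left w → start v < start w ⊎ (start v ≡ start w × len w ≤ len v)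
  left<left⇒ {v} {w} lt with ℕ.m≤n⇒m<n∨m≡n (lex-<⇒≤ˡ {p = start v} {q = start w} lt (leftKey<K w))
  ... | inj₁ sv<sw = inj₁ sv<sw
  ... | inj₂ sv≡sw = inj₂ (sv≡sw , ℕ.∸-cancelʳ-≤ (ℕ.<⇒≤ (len<ω w)) ω∸lv≤ω∸lw)
    where
    ω∸lv≤ω∸lw : ω ∸ len v ≤ ω ∸ len w
    ω∸lv≤ω∸lw = lex-<⇒≤ˡ (ℕ.+-cancelˡ-< W _ _ (lex-<⇒<ʳ {p = start v} lt sv≡sw)) (rank<ω w)

  right<right⇒ : ∀ {v w} → right v < right w → end v < end w ⊎ (end v ≡ end w × len v ≤ len w)
  right<right⇒ {v} {w} lt with ℕ.m≤n⇒m<n∨m≡n (lex-<⇒≤ˡ {p = end v} {q = end w} lt (rightKey<K w))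
  ... | inj₁ ev<ew = inj₁ ev<ew
  ... | inj₂ ev≡ew = inj₂ (ev≡ew , lex-<⇒≤ˡ (lex-<⇒<ʳ {p = end v} lt ev≡ew) (rank<ω w))

  left<right⇒ : ∀ {v w} → left v < right w → start v < end w
  left<right⇒ {v} {w} lt with ℕ.m≤n⇒m<n∨m≡n (lex-<⇒≤ˡ {p = start v} {q = end w} lt (rightKey<K w))
  ... | inj₁ sv<ew = sv<ew
  ... | inj₂ sv≡ew = ⊥-elim (ℕ.<-asym (lex-<⇒<ʳ {p = start v} lt sv≡ew) (rightKey<leftKey w v))

  interleaved⇒ : ∀ {v w} → left v < left w → left w < right v → right v < right w → Overlap v w ⊎ Twins v w
  interleaved⇒ {v} {w} ll lr rr with left<left⇒ ll | right<right⇒ rr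
  ... | inj₁ sv<sw          | inj₁ ev<ew          = inj₁ (sv<sw , left<right⇒ lr , ev<ew)
  ... | inj₁ sv<sw          | inj₂ (ev≡ew , lv≤lw) = ⊥-elim (ℕ.<-irrefl ev≡ew (ℕ.+-mono-<-≤ sv<sw lv≤lw))
  ... | inj₂ (sv≡sw , lw≤lv) | inj₁ ev<ew          = ⊥-elim (ℕ.<⇒≱ (end<end⇒len<len sv≡sw ev<ew) lw≤lv)
  ... | inj₂ (sv≡sw , lw≤lv) | inj₂ (_ , lv≤lw)     = inj₂ (sv≡sw , ℕ.≤-antisym lv≤lw lw≤lv)

  crosses⇒meets : ∀ {v w} → Crosses (chordOf v) (chordOf w) → Meets v w
  crosses⇒meets (inj₁ (ll , lr , rr)) = [ inj₁ , inj₂ ∘ inj₂ ]′ (interleaved⇒ ll lr rr)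
  crosses⇒meets (inj₂ (ll , lr , rr)) = Meets-sym ([ inj₁ , inj₂ ∘ inj₂ ]′ (interleaved⇒ ll lr rr))

  overlap⇒crosses : ∀ {v w} → Overlap v w → Crosses (chordOf v) (chordOf w)
  overlap⇒crosses {v} {w} (sv<sw , sw<ev , ev<ew) =
    inj₁ (lex-<ˡ _ sv<sw (leftKey<K v) , lex-<ˡ _ sw<ev (leftKey<K w) , lex-<ˡ _ ev<ew (rightKey<K v))

  twins⇒crosses : ∀ {v w} → Twins v w → rank v < rank w → Crosses (chordOf v) (chordOf w)
  twins⇒crosses {v} {w} (sv≡sw , lv≡lw) rv<rw = inj₁
    ( lex-<ʳ sv≡sw (ℕ.+-monoʳ-< W (lex-<ʳ {K = ω} (cong (ω ∸_) lv≡lw) rv<rw))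
    , lex-<ˡ _ (subst (_< end v) sv≡sw (start<end v)) (leftKey<K w)
    , lex-<ʳ (cong₂ _+_ sv≡sw lv≡lw) (lex-<ʳ {K = ω} lv≡lw rv<rw) )

  adjacent⇒meets : ∀ {v w} → G v w → Meets v w
  adjacent⇒meets (_ , crosses) = crosses⇒meets crosses

  overlap⇒adjacent : ∀ {v w} → Overlap v w → G v w
  overlap⇒adjacent o@(sv<sw , _) = (λ v≡w → ℕ.<-irrefl (cong start v≡w) sv<sw) , overlap⇒crosses o

  twins⇒adjacent : ∀ {v w} → Twins v w → v ≢ w → G v w ⊎ G w v
  twins⇒adjacent {v} {w} t@(sv≡sw , lv≡lw) v≢w with ℕ.<-cmp (rank v) (rank w)
  ... | tri< rv<rw _ _ = inj₁ (v≢w , twins⇒crosses t rv<rw)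
  ... | tri≈ _ rv≡rw _ = ⊥-elim (v≢w (start-len-rank-injective sv≡sw lv≡lw rv≡rw))
  ... | tri> _ _ rw<rv = inj₂ (v≢w ∘ sym , twins⇒crosses (sym sv≡sw , sym lv≡lw) rw<rv)

  meets∧start≡⇒twins : ∀ {v w} → Meets v w → start v ≡ start w → Twins v w
  meets∧start≡⇒twins (inj₁ (sv<sw , _))        sv≡sw = ⊥-elim (ℕ.<-irrefl sv≡sw sv<sw)
  meets∧start≡⇒twins (inj₂ (inj₁ (sw<sv , _))) sv≡sw = ⊥-elim (ℕ.<-irrefl (sym sv≡sw) sw<sv)
  meets∧start≡⇒twins (inj₂ (inj₂ t))           _     = t

  meets∧end≡⇒twins : ∀ {v w} → Meets v w → end v ≡ end w → Twins v w
  meets∧end≡⇒twins (inj₁ (_ , _ , ev<ew))        ev≡ew = ⊥-elim (ℕ.<-irrefl ev≡ew ev<ew)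
  meets∧end≡⇒twins (inj₂ (inj₁ (_ , _ , ew<ev))) ev≡ew = ⊥-elim (ℕ.<-irrefl (sym ev≡ew) ew<ev)
  meets∧end≡⇒twins (inj₂ (inj₂ t))               _     = t

  ¬meets∧start≡end : ∀ {v w} → start w < start v → start v ≡ end w → ¬ Meets v w
  ¬meets∧start≡end sw<sv sv≡ew (inj₁ (sv<sw , _))            = ℕ.<-asym sw<sv sv<sw
  ¬meets∧start≡end sw<sv sv≡ew (inj₂ (inj₁ (_ , sv<ew , _))) = ℕ.<-irrefl sv≡ew sv<ew
  ¬meets∧start≡end sw<sv sv≡ew (inj₂ (inj₂ (sv≡sw , _)))     = ℕ.<-irrefl (sym sv≡sw) sw<sv

  module Colouring {k} (c : Fin N → Fin k) (proper : ProperColouring G k c) where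

    ¬overlap : ∀ {v w} → c v ≡ c w → ¬ Overlap v w
    ¬overlap cv≡cw o = proper _ _ (overlap⇒adjacent o) cv≡cw

    twins⇒≡ : ∀ {v w} → c v ≡ c w → Twins v w → v ≡ w
    twins⇒≡ {v} {w} cv≡cw t with v Fin.≟ w
    ... | yes v≡w = v≡w
    ... | no  v≢w =
      ⊥-elim ([ (λ g → proper _ _ g cv≡cw) , (λ g → proper _ _ g (sym cv≡cw)) ]′ (twins⇒adjacent t v≢w))

    _⊏_ : Fin N → Fin N → Set
    w ⊏ v = start v ≤ start w × end w ≤ end v × (start v < start w ⊎ end w < end v)

    Free : Fin N → ℕ → Set
    Free v x = start v < x × x < end v × (∀ w → c w ≡ c v → w ⊏ v → ¬ (start w < x × x < end w))

    module Search (v : Fin N) where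

      -- A blocker of a candidate starts at start v, since otherwise it would overlap a
      -- same-coloured interval; so jumping to its end preserves candidacy and increases y.
      Candidate : ℕ → Set
      Candidate y = y ≡ suc (start v) ⊎ ∃ λ u → c u ≡ c v × start u ≡ start v × end u ≡ y

      Blocks : ℕ → Fin N → Set
      Blocks y w = c w ≡ c v × w ⊏ v × start w < y × y < end w

      blocks? : ∀ y w → Dec (Blocks y w)
      blocks? y w = (c w Fin.≟ c v)
               ×-dec ((start v ℕ.≤? start w) ×-dec (end w ℕ.≤? end v)
                      ×-dec ((start v ℕ.<? start w) ⊎-dec (end w ℕ.<? end v)))
               ×-dec (start w ℕ.<? y) ×-dec (y ℕ.<? end w)

      blocker-start : ∀ {y w} → Candidate y → Blocks y w → start w ≡ start v
      blocker-start (inj₁ refl) (_ , (sv≤sw , _) , sw<y , _) = ℕ.≤-antisym (ℕ.s≤s⁻¹ sw<y) sv≤sw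
      blocker-start {w = w} (inj₂ (u , cu≡cv , su≡sv , refl)) (cw≡cv , (sv≤sw , _) , sw<eu , eu<ew) =
        ℕ.≤-antisym (ℕ.≮⇒≥ λ sv<sw →
          ¬overlap (trans cu≡cv (sym cw≡cv)) (subst (_< start w) (sym su≡sv) sv<sw , sw<eu , eu<ew)) sv≤sw

      search : ∀ fuel y → start v < y → y < end v → Candidate y → end v ∸ y ≤ fuel → ∃ (Free v)
      search zero y _ y<ev _ ev∸y≤0 = ⊥-elim (ℕ.<-irrefl refl (ℕ.<-≤-trans (ℕ.m<n⇒0<n∸m y<ev) ev∸y≤0))
      search (suc fuel) y sv<y y<ev cand ev∸y≤1+fuel with Fin.any? (blocks? y)
      ... | no ¬blocked = y , sv<y , y<ev , λ w cw≡cv w⊏v (sw<y , y<ew) → ¬blocked (w , cw≡cv , w⊏v , sw<y , y<ew)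
      ... | yes (w , b@(cw≡cv , (_ , _ , strict) , _ , y<ew)) =
        search fuel (end w) (ℕ.<-trans sv<y y<ew) ew<ev (inj₂ (w , cw≡cv , sw≡sv , refl)) ev∸ew≤fuel
        where
        sw≡sv : start w ≡ start v
        sw≡sv = blocker-start cand b
        ew<ev : end w < end v
        ew<ev = [ (λ sv<sw → ⊥-elim (ℕ.<-irrefl (sym sw≡sv) sv<sw)) , (λ ew<ev → ew<ev) ]′ strict
        ev∸ew≤fuel : end v ∸ end w ≤ fuel
        ev∸ew≤fuel = ℕ.s≤s⁻¹ (ℕ.<-≤-trans (ℕ.∸-monoʳ-< y<ew (ℕ.<⇒≤ ew<ev)) ev∸y≤1+fuel)

      free : ∃ (Free v)
      free = search (end v) (suc (start v)) ℕ.≤-refl 1+sv<ev (inj₁ refl) (ℕ.m∸n≤m (end v) (suc (start v)))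
        where
        1+sv<ev : suc (start v) < end v
        1+sv<ev = subst (_< end v) (ℕ.+-comm (start v) 1) (ℕ.+-monoʳ-< (start v) {1} {len v} (s≤s (s≤s z≤n)))

    φ : Fin N → ℕ
    φ v = proj₁ (Search.free v)

    φ-free : ∀ v → Free v (φ v)
    φ-free v = proj₂ (Search.free v)

    φ-¬⊏ : ∀ {v w} → c v ≡ c w → φ v ≡ φ w → ¬ (v ⊏ w)
    φ-¬⊏ {v} {w} cv≡cw φv≡φw v⊏w with φ-free v | φ-free w
    ... | sv<φv , φv<ev , _ | _ , _ , free-w =
      free-w v cv≡cw v⊏w (subst (start v <_) φv≡φw sv<φv , subst (_< end v) φv≡φw φv<ev)

    φ-start-≮ : ∀ {v w} → c v ≡ c w → φ v ≡ φ w → ¬ (start v < start w)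
    φ-start-≮ {v} {w} cv≡cw φv≡φw sv<sw with end v ℕ.<? end w
    ... | yes ev<ew = ¬overlap cv≡cw (sv<sw , sw<ev , ev<ew)
      where
      sw<ev : start w < end v
      sw<ev = ℕ.<-trans (subst (start w <_) (sym φv≡φw) (proj₁ (φ-free w))) (proj₁ (proj₂ (φ-free v)))
    ... | no  ev≮ew = φ-¬⊏ (sym cv≡cw) (sym φv≡φw) (ℕ.<⇒≤ sv<sw , ℕ.≮⇒≥ ev≮ew , inj₁ sv<sw)

    φ-start-≡ : ∀ {v w} → c v ≡ c w → φ v ≡ φ w → start v ≡ start w
    φ-start-≡ cv≡cw φv≡φw =
      ℕ.≤-antisym (ℕ.≮⇒≥ (φ-start-≮ (sym cv≡cw) (sym φv≡φw))) (ℕ.≮⇒≥ (φ-start-≮ cv≡cw φv≡φw))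

    φ-injective : ∀ {v w} → c v ≡ c w → φ v ≡ φ w → v ≡ w
    φ-injective {v} {w} cv≡cw φv≡φw with φ-start-≡ cv≡cw φv≡φw | ℕ.<-cmp (end v) (end w)
    ... | sv≡sw | tri< ev<ew _ _ = ⊥-elim (φ-¬⊏ cv≡cw φv≡φw (ℕ.≤-reflexive (sym sv≡sw) , ℕ.<⇒≤ ev<ew , inj₂ ev<ew))
    ... | sv≡sw | tri≈ _ ev≡ew _ =
      twins⇒≡ cv≡cw (sv≡sw , ℕ.+-cancelˡ-≡ (start v) _ _ (trans ev≡ew (cong (_+ len w) (sym sv≡sw))))
    ... | sv≡sw | tri> _ _ ew<ev = ⊥-elim (φ-¬⊏ (sym cv≡cw) (sym φv≡φw) (ℕ.≤-reflexive sv≡sw , ℕ.<⇒≤ ew<ev , inj₂ ew<ev))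

    φ<M+ω : ∀ v → φ v < M + ω
    φ<M+ω v = ℕ.<-trans (proj₁ (proj₂ (φ-free v))) (ℕ.+-mono-< (start<M v) (len<ω v))

    N≤k*[M+ω] : N ≤ k * (M + ω)
    N≤k*[M+ω] = Fin.injective⇒≤ {f = λ v → combine (c v) (Fin.fromℕ< (φ<M+ω v))} λ {v} {w} eq →
      let cv≡cw , φv≡φw = Fin.combine-injective (c v) _ (c w) _ eq
      in  φ-injective cv≡cw (Fin.fromℕ<-injective _ _ (φ<M+ω v) (φ<M+ω w) φv≡φw)

  floorSum≤colours : ∀ {k} (c : Fin N → Fin k) → ProperColouring G k c → S ≤ k
  floorSum≤colours c proper = m*[m*n]≤k*[m*n+n]⇒m≤k S _ ω (Colouring.N≤k*[M+ω] c proper)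

  module Clique (ys : List (Fin N)) (clique : IsClique G ys) (p₀ : Fin (length ys))
                (minimal : ∀ p → len (lookup ys p₀) ≤ len (lookup ys p)) where

    v₀ : Fin N
    v₀ = lookup ys p₀

    a L : ℕ
    a = start v₀
    L = len v₀

    meets-v₀ : ∀ p → Meets v₀ (lookup ys p)
    meets-v₀ p with p Fin.≟ p₀
    ... | yes refl = inj₂ (inj₂ (refl , refl))
    ... | no  p≢p₀ = [ Meets-sym ∘ adjacent⇒meets , adjacent⇒meets ]′ (AllPairs-lookup clique p≢p₀)

    anchor : Fin N → ℕ
    anchor w with a ℕ.≤? start w
    ... | yes _ = start w
    ... | no  _ = end w

    anchor-bounds : ∀ {w} → Meets v₀ w → a ≤ anchor w × anchor w < a + L
    anchor-bounds {w} m with a ℕ.≤? start w | m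
    ... | yes a≤sw | inj₁ (_ , sw<e₀ , _)          = a≤sw , sw<e₀
    ... | yes a≤sw | inj₂ (inj₁ (sw<a , _))        = ⊥-elim (ℕ.<⇒≱ sw<a a≤sw)
    ... | yes a≤sw | inj₂ (inj₂ (a≡sw , _))        = a≤sw , subst (_< a + L) a≡sw (ℕ.m<m+n a ℕ.z<s)
    ... | no  a≰sw | inj₁ (a<sw , _)               = ⊥-elim (a≰sw (ℕ.<⇒≤ a<sw))
    ... | no  a≰sw | inj₂ (inj₁ (_ , a<ew , ew<e₀)) = ℕ.<⇒≤ a<ew , ew<e₀
    ... | no  a≰sw | inj₂ (inj₂ (a≡sw , _))        = ⊥-elim (a≰sw (ℕ.≤-reflexive a≡sw))

    anchor-injective : ∀ {w w′} → Meets w w′ → anchor w ≡ anchor w′ → Twins w w′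
    anchor-injective {w} {w′} m eq with a ℕ.≤? start w | a ℕ.≤? start w′
    ... | yes _    | yes _     = meets∧start≡⇒twins m eq
    ... | no  _    | no  _     = meets∧end≡⇒twins m eq
    ... | yes a≤sw | no  a≰sw′ = ⊥-elim (¬meets∧start≡end (ℕ.<-≤-trans (ℕ.≰⇒> a≰sw′) a≤sw) eq m)
    ... | no  a≰sw | yes a≤sw′ = ⊥-elim (¬meets∧start≡end (ℕ.<-≤-trans (ℕ.≰⇒> a≰sw) a≤sw′) (sym eq) (Meets-sym m))

    slot : Fin (length ys) → ℕ
    slot p = rank (lookup ys p) * L + (anchor (lookup ys p) ∸ a)

    offset<L : ∀ p → anchor (lookup ys p) ∸ a < L
    offset<L p = ℕ.m<n+o⇒m∸n<o _ a (proj₂ (anchor-bounds (meets-v₀ p)))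

    slot<ω : ∀ p → slot p < ω
    slot<ω p = ℕ.<-≤-trans (lex-<ˡ 0 rank<ω/L (offset<L p))
                           (ℕ.≤-trans (ℕ.≤-reflexive (ℕ.+-identityʳ _)) (m/n*n≤m ω L))
      where
      rank<ω/L : rank (lookup ys p) < ω / L
      rank<ω/L = ℕ.<-≤-trans (rank<ω/len (lookup ys p)) (/-monoʳ-≤ ω (minimal p))

    slot-injective : ∀ {p q} → slot p ≡ slot q → p ≡ q
    slot-injective {p} {q} eq with p Fin.≟ q
    ... | yes p≡q = p≡q
    ... | no  p≢q = ⊥-elim ([ proj₁ , (λ g → proj₁ g ∘ sym) ]′ adjacent wp≡wq)
      where
      wp wq : Fin N
      wp = lookup ys p
      wq = lookup ys q
      adjacent : G wp wq ⊎ G wq wp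
      adjacent = AllPairs-lookup clique p≢q
      rank≡×offset≡ : rank wp ≡ rank wq × anchor wp ∸ a ≡ anchor wq ∸ a
      rank≡×offset≡ = lex-injective (offset<L p) (offset<L q) eq
      anchor≡ : anchor wp ≡ anchor wq
      anchor≡ = ℕ.∸-cancelʳ-≡ (proj₁ (anchor-bounds (meets-v₀ p))) (proj₁ (anchor-bounds (meets-v₀ q)))
                              (proj₂ rank≡×offset≡)
      twins : Twins wp wq
      twins = anchor-injective ([ adjacent⇒meets , Meets-sym ∘ adjacent⇒meets ]′ adjacent) anchor≡
      wp≡wq : wp ≡ wq
      wp≡wq = start-len-rank-injective (proj₁ twins) (proj₂ twins) (proj₁ rank≡×offset≡)

    length≤ω : length ys ≤ ω
    length≤ω = Fin.injective⇒≤ {f = λ p → Fin.fromℕ< (slot<ω p)} λ {p} {q} eq →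
      slot-injective (Fin.fromℕ<-injective _ _ (slot<ω p) (slot<ω q) eq)

  cliqueNumber≤ω : CliqueNumber≤ G ω
  cliqueNumber≤ω []          _      = z≤n
  cliqueNumber≤ω ys@(_ ∷ xs) clique with argmin (length xs) (len ∘ lookup ys)
  ... | p₀ , minimal = Clique.length≤ω ys clique p₀ minimal

theorem2 : (ω : ℕ) → .{{_ : NonZero ω}} →
    ∃ λ n → ∃ λ (D : ChordDiagram n) →
      CliqueNumber≤ (circleGraph D) ω × ChromaticNumber≥ωLnωMinus2 (circleGraph D) ω
theorem2 ω = N , chordDiagram , cliqueNumber≤ω , λ k c proper →
  floorSum≤⇒AtLeastωLnωMinus2 ω k (floorSum≤colours c proper)
  where open Construction ω
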